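{- Let $D$ be a symmetric $(81,16,3)$ design (if one exists) and let $\alpha$ be an automorphism of $D$ of order $5$. Then $|F(\alpha)|=1$.
   Context: A symmetric $(v,k,\lambda)$ design, for integers $v>k>\lambda\geq 0$, is a pair $D=(V,\mathcal{B})$ where $V$ is a set of $v$ points and $\mathcal{B}$ is a set of $k$-subsets of $V$ (blocks) such that $|\mathcal{B}|=v$, every point lies in exactly $k$ blocks, any two distinct blocks meet in exactly $\lambda$ points, and any two distinct points lie in exactly $\lambda$ common blocks. An automorphism of $D$ is a permutation of $V$ mapping blocks to blocks. $F(\alpha)$ denotes the set of points fixed by $\alpha$. -}

module Defs where

open import Data.Nat using (ℕ; zero; suc; _<_)
open import Data.Fin using (Fin)
open import Data.Fin.Subset using (Subset; _∈_; _∩_; ∣_∣)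
open import Data.Fin.Subset.Properties using (_∈?_)
open import Data.Fin.Properties using (_≟_)
open import Data.Fin.Permutation using (Permutation′; _⟨$⟩ʳ_)
open import Data.List using (List; length; filter)
open import Data.List.Base using (allFin)
open import Data.Product using (∃; _×_)
open import Relation.Nullary using (Dec; ¬_)
open import Relation.Nullary.Decidable using (_×-dec_)
open import Function using (_⇔_)
open import Relation.Binary.PropositionalEquality using (_≡_; _≢_)

count : ∀ {n} (P : Fin n → Set) → (∀ x → Dec (P x)) → ℕ
count {n} P P? = length (filter P? (allFin n))

-- A symmetric (v,k,λ) design on the point set Fin v.
-- Blocks are given as a family B : Fin v → Subset v (v blocks) which is
-- injective, so that the block set has exactly v elements.
record IsSymmetricDesign (v k lam : ℕ) (B : Fin v → Subset v) : Set where
  field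
    v>k       : k < v
    k>λ       : lam < k
    distinct  : ∀ b c → B b ≡ B c → b ≡ c
    blockSize : ∀ b → ∣ B b ∣ ≡ k
    repl      : ∀ p → count (λ b → p ∈ B b) (λ b → p ∈? B b) ≡ k
    blockMeet : ∀ b c → b ≢ c → ∣ B b ∩ B c ∣ ≡ lam
    pointPair : ∀ p q → p ≢ q →
                count (λ b → p ∈ B b × q ∈ B b)
                      (λ b → (p ∈? B b) ×-dec (q ∈? B b)) ≡ lam

IsAutomorphism : ∀ {v} → (Fin v → Subset v) → Permutation′ v → Set
IsAutomorphism {v} B α = ∀ b → ∃ λ c → ∀ p → (p ∈ B b) ⇔ ((α ⟨$⟩ʳ p) ∈ B c)

iter : ∀ {v} → Permutation′ v → ℕ → Fin v → Fin v
iter α zero    x = x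
iter α (suc n) x = α ⟨$⟩ʳ iter α n x

IsIdentityMap : ∀ {v} → (Fin v → Fin v) → Set
IsIdentityMap f = ∀ x → f x ≡ x

HasOrder : ∀ {v} → Permutation′ v → ℕ → Set
HasOrder α n = (0 < n) × IsIdentityMap (iter α n)
             × (∀ m → 0 < m → m < n → ¬ IsIdentityMap (iter α m))

numFixed : ∀ {v} → Permutation′ v → ℕ
numFixed α = count (λ p → α ⟨$⟩ʳ p ≡ p) (λ p → (α ⟨$⟩ʳ p) ≟ p)

module Submission where

-- Let f and φ be the numbers of fixed points and fixed blocks of α, and t p
-- the number of fixed blocks through a point p.  Every orbit of ⟨α⟩ has size
-- 1 or 5, so counting an α-invariant set modulo 5 only sees its fixed members
-- (OrderFive.orbit-count).  Hence f ≡ φ ≡ 81 and, for fixed p, t p ≡ 16 (mod 5);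
-- two fixed points lie on exactly 3 fixed blocks and two fixed blocks meet in
-- exactly 3 points, all fixed.  So if f ≥ 2, then t p ∈ {6, 11, 16} for fixed p,
-- and a non-fixed point lies on at most one fixed block.  With I = Σ t p and
-- X = Σ (t p)² over the fixed points, double counting gives X + 3φ = 3φ² + I,
-- 16φ + f ≤ I + 81 and 6f ≤ I, while t p ∈ {6, 11, 16} gives 17 I ≤ X + 66 f
-- and 27 I ≤ X + 176 f.  Eliminating I and X leaves three conditions on (f, φ)
-- which fail for every f ∈ {6, …, 76} (checked by evaluation); f = 81 would make
-- α the identity.  Hence f = 1.

open import Data.Nat using (ℕ; zero; suc; _+_; _*_; _∸_; _≤_; _<_; z≤n; s≤s; s≤s⁻¹)
import Data.Nat.Properties as ℕ
open import Data.Fin using (Fin; zero; suc; toℕ)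
open import Data.Fin.Permutation using (Permutation′; permutation; _⟨$⟩ʳ_)
open import Data.Nat.DivMod using (_/_; _mod_; _divMod_; DivMod)
open import Data.Fin.Properties using (_≟_; suc-injective; toℕ-injective; toℕ<n; all?)
open import Data.Fin.Subset using (Subset; _∈_; _∩_; _⊆_; ∣_∣; inside; outside)
open import Data.Fin.Subset.Properties using (_∈?_; ⊆-antisym; x∈p∩q⁺; x∈p∩q⁻)
open import Data.Vec using ([]; _∷_)
open import Data.List using (length; filter; tabulate)
open import Data.Product using (∃; _×_; _,_; proj₁; proj₂)
open import Data.Sum using (inj₁; inj₂; [_,_]′)
open import Data.Empty using (⊥-elim)
open import Data.Unit using (tt; ⊤)
open import Relation.Nullary using (Dec; yes; no; ¬_; does)
open import Data.Bool using (if_then_else_)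
open import Relation.Nullary.Decidable using (_×-dec_; ¬?; toWitness; True)
open import Relation.Binary.PropositionalEquality
open import Algebra.Properties.Semiring.Sum ℕ.+-*-semiring
  using (sum; sum-cong-≗; ∑-distrib-+; ∑-comm; sum-permute; *-distribˡ-sum; *-distribʳ-sum)
open import Algebra.Properties.CommutativeSemigroup ℕ.*-commutativeSemigroup
  using (x∙yz≈y∙xz; x∙yz≈xz∙y; xy∙z≈xz∙y)
open import Defs
open import Function using (Equivalence)

ind : ∀ {a} {A : Set a} → Dec A → ℕ
ind d = if does d then 1 else 0

ind≤1 : ∀ {a} {A : Set a} (d : Dec A) → ind d ≤ 1
ind≤1 (yes _) = s≤s z≤n
ind≤1 (no _)  = z≤n

ind-cong : ∀ {a b} {A : Set a} {B : Set b} (d : Dec A) (e : Dec B) →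
           (A → B) → (B → A) → ind d ≡ ind e
ind-cong (yes _) (yes _) _   _   = refl
ind-cong (yes a) (no ¬b) a→b _   = ⊥-elim (¬b (a→b a))
ind-cong (no ¬a) (yes b) _   b→a = ⊥-elim (¬a (b→a b))
ind-cong (no _)  (no _)  _   _   = refl

ind-yes : ∀ {a} {A : Set a} (d : Dec A) → A → ind d ≡ 1
ind-yes (yes _) _ = refl
ind-yes (no ¬a) a = ⊥-elim (¬a a)

ind-elim : ∀ {a ℓ} {A : Set a} (Q : ℕ → Set ℓ) (d : Dec A) → (¬ A → Q 0) → (A → Q 1) → Q (ind d)
ind-elim Q (yes a) _  q₁ = q₁ a
ind-elim Q (no ¬a) q₀ _  = q₀ ¬a

ind-*-cong : ∀ {a} {A : Set a} (d : Dec A) {x y} → (A → x ≡ y) → ind d * x ≡ ind d * y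
ind-*-cong d {x} {y} eq = ind-elim (λ i → i * x ≡ i * y) d (λ _ → refl) (λ a → cong (_+ 0) (eq a))

ind-idem : ∀ {a} {A : Set a} (d : Dec A) → ind d * ind d ≡ ind d
ind-idem d = ind-elim (λ i → i * i ≡ i) d (λ _ → refl) (λ _ → refl)

ind-× : ∀ {a b} {A : Set a} {B : Set b} (d : Dec A) (e : Dec B) →
        ind (d ×-dec e) ≡ ind d * ind e
ind-× (yes _) (yes _) = refl
ind-× (yes _) (no _)  = refl
ind-× (no _)  (yes _) = refl
ind-× (no _)  (no _)  = refl

ind-×-positive : ∀ {a b} {A : Set a} {B : Set b} (d : Dec A) (e : Dec B) →
                 0 < ind d * ind e → A × B
ind-×-positive (yes a) (yes b) _ = a , b
ind-×-positive (yes _) (no _)  ()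
ind-×-positive (no _)  (yes _) ()
ind-×-positive (no _)  (no _)  ()

ind-split : ∀ {a} {A : Set a} (d : Dec A) c → c ≡ ind d * c + ind (¬? d) * c
ind-split (yes _) c = sym (trans (ℕ.+-identityʳ _) (ℕ.+-identityʳ c))
ind-split (no _)  c = sym (ℕ.+-identityʳ c)

unless-weight-one : ∀ {a} {A : Set a} (d : Dec A) c {w} → (¬ A → w ≡ 1) →
                    ind (¬? d) * c ≡ ind (¬? d) * c * w
unless-weight-one (yes _) c _    = refl
unless-weight-one (no ¬a) c w≡1 = sym (trans (cong ((1 * c) *_) (w≡1 ¬a)) (ℕ.*-identityʳ (1 * c)))

count-as-sum : ∀ {n} (P : Fin n → Set) (P? : ∀ x → Dec (P x)) →
               count P P? ≡ sum (λ i → ind (P? i))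
count-as-sum {n} P P? = length-filter-tabulate (λ i → i)
  where
  length-filter-tabulate : ∀ {m} (h : Fin m → Fin n) →
    length (filter P? (tabulate h)) ≡ sum (λ i → ind (P? (h i)))
  length-filter-tabulate {zero}  h = refl
  length-filter-tabulate {suc m} h with P? (h zero)
  ... | yes _ = cong suc (length-filter-tabulate (λ i → h (suc i)))
  ... | no _  = length-filter-tabulate (λ i → h (suc i))

card-as-sum : ∀ {n} (s : Subset n) →
              ∣ s ∣ ≡ sum (λ i → ind (i ∈? s))
card-as-sum []            = refl
card-as-sum (inside ∷ s)  = cong suc (card-as-sum s)
card-as-sum (outside ∷ s) = card-as-sum s

sum-mono-≤ : ∀ {n} {f h : Fin n → ℕ} → (∀ i → f i ≤ h i) → sum f ≤ sum h
sum-mono-≤ {zero}  _  = z≤n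
sum-mono-≤ {suc n} le = ℕ.+-mono-≤ (le zero) (sum-mono-≤ (λ i → le (suc i)))

term≤sum : ∀ {n} (h : Fin n → ℕ) (i : Fin n) → h i ≤ sum h
term≤sum h zero    = ℕ.m≤m+n (h zero) _
term≤sum h (suc i) = ℕ.≤-trans (term≤sum (λ j → h (suc j)) i) (ℕ.m≤n+m _ (h zero))

sum-const : ∀ n (c : ℕ) → sum {n} (λ _ → c) ≡ n * c
sum-const zero    c = refl
sum-const (suc n) c = cong (c +_) (sum-const n c)

sum-zero : ∀ {n} (h : Fin n → ℕ) → (∀ i → h i ≡ 0) → sum h ≡ 0
sum-zero {n} h h≡0 = trans (sum-cong-≗ h≡0) (trans (sum-const n 0) (ℕ.*-zeroʳ n))

sum-δ : ∀ {n} (j : Fin n) (h : Fin n → ℕ) → sum (λ i → ind (i ≟ j) * h i) ≡ h j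
sum-δ {suc n} zero h = begin
  h zero + 0 + sum (λ i → 0 * h (suc i))
    ≡⟨ cong (h zero + 0 +_) (sum-zero (λ i → 0 * h (suc i)) (λ _ → refl)) ⟩
  h zero + 0 + 0
    ≡⟨ trans (ℕ.+-identityʳ _) (ℕ.+-identityʳ _) ⟩
  h zero ∎
  where open ≡-Reasoning
sum-δ {suc n} (suc j) h = sum-δ j (λ i → h (suc i))

sum-ind-unique : ∀ {n} {P : Fin n → Set} (P? : ∀ i → Dec (P i)) (j : Fin n) →
                 P j → (∀ i → P i → i ≡ j) → sum (λ i → ind (P? i)) ≡ 1
sum-ind-unique {P = P} P? j pj unique = trans (sum-cong-≗ as-δ) (sum-δ j (λ _ → 1))
  where
  as-δ : ∀ i → ind (P? i) ≡ ind (i ≟ j) * 1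
  as-δ i = trans (ind-cong (P? i) (i ≟ j) (unique i) (λ i≡j → subst P (sym i≡j) pj))
                 (sym (ℕ.*-identityʳ _))

sum-positive : ∀ {n} (h : Fin n → ℕ) → 0 < sum h → ∃ λ i → 0 < h i
sum-positive {suc n} h pos with h zero in eq
... | suc _ = zero , subst (0 <_) (sym eq) (s≤s z≤n)
... | zero with sum-positive (λ i → h (suc i)) pos
...   | i , hi>0 = suc i , hi>0

full-weight : ∀ {n} {A : Fin n → Set} (A? : ∀ x → Dec (A x)) (k : Fin n → ℕ) →
              sum (λ x → ind (A? x) * k x) ≡ sum k → ∀ x → 0 < k x → A x
full-weight {n} A? k full x kx>0 =
  from-rest (A? x) kx>0 (ℕ.n≤0⇒n≡0 (subst (rest x ≤_) rest-zero (term≤sum rest x)))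
  where
  rest : Fin n → ℕ
  rest y = ind (¬? (A? y)) * k y
  rest-zero : sum rest ≡ 0
  rest-zero = ℕ.+-cancelˡ-≡ (sum (λ y → ind (A? y) * k y)) _ 0 (begin
    sum (λ y → ind (A? y) * k y) + sum rest  ≡⟨ ∑-distrib-+ (λ y → ind (A? y) * k y) rest ⟨
    sum (λ y → ind (A? y) * k y + rest y)    ≡⟨ sum-cong-≗ (λ y → ind-split (A? y) (k y)) ⟨
    sum k                                    ≡⟨ full ⟨
    sum (λ y → ind (A? y) * k y)             ≡⟨ ℕ.+-identityʳ _ ⟨
    sum (λ y → ind (A? y) * k y) + 0         ∎)
    where open ≡-Reasoning
  from-rest : ∀ {a} {A : Set a} (d : Dec A) {c} → 0 < c → ind (¬? d) * c ≡ 0 → A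
  from-rest (yes a) _ _ = a
  from-rest (no _) {suc c} _ ()

sum-≤1 : ∀ {n} (h : Fin n → ℕ) → (∀ i → h i ≤ 1) →
         (∀ i j → 0 < h i → 0 < h j → i ≡ j) → sum h ≤ 1
sum-≤1 {zero}  h _   _      = z≤n
sum-≤1 {suc n} h ≤1 unique with h zero in eq
... | zero  = sum-≤1 (λ i → h (suc i)) (λ i → ≤1 (suc i))
                (λ i j hi hj → suc-injective (unique (suc i) (suc j) hi hj))
... | suc k = subst (_≤ 1) (sym (trans (cong (suc k +_) (sum-zero _ rest-zero)) (ℕ.+-identityʳ _)))
                (subst (_≤ 1) eq (≤1 zero))
  where
  rest-zero : ∀ i → h (suc i) ≡ 0
  rest-zero i with h (suc i) in eq′
  ... | zero  = refl
  ... | suc _ with unique zero (suc i) (subst (0 <_) (sym eq) (s≤s z≤n))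
                                       (subst (0 <_) (sym eq′) (s≤s z≤n))
  ...   | ()

argmin : ∀ {k} (h : Fin (suc k) → ℕ) → ∃ λ j → ∀ i → h j ≤ h i
argmin {zero} h = zero , λ { zero → ℕ.≤-refl }
argmin {suc k} h with argmin (λ i → h (suc i))
... | j , min with h zero ℕ.≤? h (suc j)
...   | yes h0≤ = zero  , λ { zero → ℕ.≤-refl ; (suc i) → ℕ.≤-trans h0≤ (min i) }
...   | no  h0≰ = suc j , λ { zero → ℕ.<⇒≤ (ℕ.≰⇒> h0≰) ; (suc i) → min i }

double-count : ∀ {m k} (w : Fin m → ℕ) (v : Fin k → ℕ) (a : Fin m → Fin k → ℕ) →
  sum (λ i → w i * sum (λ j → v j * a i j)) ≡ sum (λ j → v j * sum (λ i → w i * a i j))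
double-count w v a = begin
  sum (λ i → w i * sum (λ j → v j * a i j))
    ≡⟨ sum-cong-≗ (λ i → *-distribˡ-sum (w i) (λ j → v j * a i j)) ⟩
  sum (λ i → sum (λ j → w i * (v j * a i j)))
    ≡⟨ ∑-comm (λ i j → w i * (v j * a i j)) ⟩
  sum (λ j → sum (λ i → w i * (v j * a i j)))
    ≡⟨ sum-cong-≗ (λ j → sum-cong-≗ (λ i → x∙yz≈y∙xz (w i) (v j) (a i j))) ⟩
  sum (λ j → sum (λ i → v j * (w i * a i j)))
    ≡⟨ sum-cong-≗ (λ j → *-distribˡ-sum (v j) (λ i → w i * a i j)) ⟨
  sum (λ j → v j * sum (λ i → w i * a i j)) ∎
  where open ≡-Reasoning

iterate : ∀ {A : Set} → (A → A) → ℕ → A → A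
iterate f zero    x = x
iterate f (suc k) x = f (iterate f k x)

iterate-+ : ∀ {A : Set} (f : A → A) a b x → iterate f (a + b) x ≡ iterate f a (iterate f b x)
iterate-+ f zero    b x = refl
iterate-+ f (suc a) b x = cong f (iterate-+ f a b x)

iterate-comm : ∀ {A : Set} (f : A → A) k x → iterate f k (f x) ≡ f (iterate f k x)
iterate-comm f zero    x = refl
iterate-comm f (suc k) x = cong f (iterate-comm f k x)

iterate-multiple : ∀ {A : Set} (f : A → A) k d y → iterate f d y ≡ y → iterate f (k * d) y ≡ y
iterate-multiple f zero    d y fix = refl
iterate-multiple f (suc k) d y fix =
  trans (iterate-+ f d (k * d) y) (trans (cong (iterate f d) (iterate-multiple f k d y fix)) fix)

-- Every non-fixed point
-- lies in an orbit of exactly five points, which yields the congruence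
--   #{x | P x} ≡ #{x fixed | P x}  (mod 5)
-- for every g-invariant predicate P (orbit-count).  Orbits are counted by
-- giving weight 1 to the least point (by index) of each orbit.
module OrderFive {n : ℕ} (g : Fin n → Fin n) (g⁵ : ∀ x → iterate g 5 x ≡ x) where

  g-injective : ∀ {x y} → g x ≡ g y → x ≡ y
  g-injective {x} {y} gx≡gy =
    trans (sym (g⁵ x)) (trans (cong (iterate g 4) gx≡gy) (g⁵ y))

  iterate-injective : ∀ k {x y} → iterate g k x ≡ iterate g k y → x ≡ y
  iterate-injective zero    eq = eq
  iterate-injective (suc k) eq = iterate-injective k (g-injective eq)

  periodic : ∀ r q x → iterate g (r + q * 5) x ≡ iterate g r x
  periodic r q x = trans (iterate-+ g r (q * 5) x) (cong (iterate g r) (iterate-5q q))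
    where
    iterate-5q : ∀ q → iterate g (q * 5) x ≡ x
    iterate-5q zero    = refl
    iterate-5q (suc q) = trans (iterate-+ g 5 (q * 5) x)
                               (trans (g⁵ _) (iterate-5q q))

  reduce : ∀ m x → iterate g m x ≡ iterate g (toℕ (m mod 5)) x
  reduce m x = trans (cong (λ k → iterate g k x) (DivMod.property (m divMod 5)))
                     (periodic (toℕ (m mod 5)) (m / 5) x)

  -- A point fixed by a power gᵈ with 0 < d < 5 is fixed by g, since
  -- some multiple of d is ≡ 1 (mod 5).
  fixed-power : ∀ d y → 0 < d → d < 5 → iterate g d y ≡ y → g y ≡ y
  fixed-power 0 y () _ _
  fixed-power 1 y _ _ fix = fix
  fixed-power 2 y _ _ fix = trans (sym (periodic 1 1 y)) (iterate-multiple g 3 2 y fix)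
  fixed-power 3 y _ _ fix = trans (sym (periodic 1 1 y)) (iterate-multiple g 2 3 y fix)
  fixed-power 4 y _ _ fix = trans (sym (periodic 1 3 y)) (iterate-multiple g 4 4 y fix)
  fixed-power (suc (suc (suc (suc (suc _))))) y _ (s≤s (s≤s (s≤s (s≤s (s≤s ())))))

  orbit-distinct : ∀ x → g x ≢ x → ∀ a b → b < 5 → a ≤ b →
                   iterate g a x ≡ iterate g b x → a ≡ b
  orbit-distinct x moving a b b<5 a≤b gᵃx≡gᵇx with b ∸ a in b∸a≡1+d
  ... | zero  = ℕ.≤-antisym a≤b (ℕ.m∸n≡0⇒m≤n b∸a≡1+d)
  ... | suc d = ⊥-elim (moving (iterate-injective a (trans (iterate-comm g a x) gy≡y)))
    where
    y : Fin n
    y = iterate g a x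
    gᵈy≡y : iterate g (suc d) y ≡ y
    gᵈy≡y = begin
      iterate g (suc d) y      ≡⟨ iterate-+ g (suc d) a x ⟨
      iterate g (suc d + a) x  ≡⟨ cong (λ k → iterate g (k + a) x) b∸a≡1+d ⟨
      iterate g (b ∸ a + a) x  ≡⟨ cong (λ k → iterate g k x) (ℕ.m∸n+n≡m a≤b) ⟩
      iterate g b x            ≡⟨ gᵃx≡gᵇx ⟨
      y                        ∎
      where open ≡-Reasoning
    gy≡y : g y ≡ y
    gy≡y = fixed-power (suc d) y (s≤s z≤n)
             (ℕ.≤-<-trans (ℕ.≤-reflexive (sym b∸a≡1+d)) (ℕ.≤-<-trans (ℕ.m∸n≤m b a) b<5)) gᵈy≡y

  orbit-distinct-Fin : ∀ x → g x ≢ x → ∀ (i j : Fin 5) →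
                       iterate g (toℕ i) x ≡ iterate g (toℕ j) x → i ≡ j
  orbit-distinct-Fin x moving i j eq with ℕ.≤-total (toℕ i) (toℕ j)
  ... | inj₁ i≤j = toℕ-injective (orbit-distinct x moving _ _ (toℕ<n j) i≤j eq)
  ... | inj₂ j≤i = toℕ-injective (sym (orbit-distinct x moving _ _ (toℕ<n i) j≤i (sym eq)))

  same-orbit : ∀ i j x → i ≤ 5 →
               iterate g (j + (5 ∸ i)) (iterate g i x) ≡ iterate g j x
  same-orbit i j x i≤5 = begin
    iterate g (j + (5 ∸ i)) (iterate g i x)  ≡⟨ iterate-+ g (j + (5 ∸ i)) i x ⟨
    iterate g (j + (5 ∸ i) + i) x            ≡⟨ cong (λ k → iterate g k x) j+5 ⟩
    iterate g (j + 1 * 5) x                  ≡⟨ periodic j 1 x ⟩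
    iterate g j x                            ∎
    where
    open ≡-Reasoning
    j+5 : j + (5 ∸ i) + i ≡ j + 1 * 5
    j+5 = trans (ℕ.+-assoc j (5 ∸ i) i) (cong (j +_) (ℕ.m∸n+n≡m i≤5))

  Least : Fin n → Set
  Least x = ∀ (i : Fin 5) → toℕ x ≤ toℕ (iterate g (toℕ i) x)

  least? : ∀ x → Dec (Least x)
  least? x = all? (λ i → toℕ x ℕ.≤? toℕ (iterate g (toℕ i) x))

  least-all : ∀ {x} → Least x → ∀ m → toℕ x ≤ toℕ (iterate g m x)
  least-all {x} least m = subst (λ y → toℕ x ≤ toℕ y) (sym (reduce m x)) (least (m mod 5))

  orbit-least-unique : ∀ x → g x ≢ x →
                       sum (λ (i : Fin 5) → ind (least? (iterate g (toℕ i) x))) ≡ 1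
  orbit-least-unique x moving =
    sum-ind-unique (λ i → least? (iterate g (toℕ i) x)) j least-j unique
    where
    orbitIndex : Fin 5 → ℕ
    orbitIndex i = toℕ (iterate g (toℕ i) x)
    j : Fin 5
    j = proj₁ (argmin orbitIndex)

    least-j : Least (iterate g (toℕ j) x)
    least-j k = subst (λ y → orbitIndex j ≤ toℕ y)
                  (trans (sym (reduce (toℕ k + toℕ j) x)) (iterate-+ g (toℕ k) (toℕ j) x))
                  (proj₂ (argmin orbitIndex) ((toℕ k + toℕ j) mod 5))

    below : ∀ a b → Least (iterate g (toℕ a) x) → orbitIndex a ≤ orbitIndex b
    below a b least = subst (λ y → orbitIndex a ≤ toℕ y)
                        (same-orbit (toℕ a) (toℕ b) x (ℕ.<⇒≤ (toℕ<n a)))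
                        (least-all least (toℕ b + (5 ∸ toℕ a)))

    unique : ∀ i → Least (iterate g (toℕ i) x) → i ≡ j
    unique i least = orbit-distinct-Fin x moving i j
                       (toℕ-injective (ℕ.≤-antisym (below i j least) (below j i least-j)))

  g-permutation : Permutation′ n
  g-permutation = permutation g (iterate g 4) g⁵ g⁵

  reindex : ∀ k (h : Fin n → ℕ) → sum (λ x → h (iterate g k x)) ≡ sum h
  reindex zero    h = refl
  reindex (suc k) h = trans (reindex k (λ x → h (g x))) (sym (sum-permute h g-permutation))

  -- The non-fixed points satisfying a g-invariant decidable predicate P.
  -- Their indicator is constant on orbits, and each orbit carries total
  -- least-point weight 1, so their number is 5 times the number of orbits.
  module Moving {P : Fin n → Set} (P? : ∀ x → Dec (P x)) (invariant : ∀ x → P x → P (g x)) where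

    moving : Fin n → ℕ
    moving x = ind (¬? (g x ≟ x)) * ind (P? x)

    leastWeight : Fin n → ℕ
    leastWeight x = ind (least? x)

    orbitWeight : Fin n → ℕ
    orbitWeight x = sum (λ (i : Fin 5) → leastWeight (iterate g (toℕ i) x))

    orbits : ℕ
    orbits = sum (λ x → moving x * leastWeight x)

    moving-invariant : ∀ x → moving (g x) ≡ moving x
    moving-invariant x = cong₂ _*_
      (ind-cong (¬? (g (g x) ≟ g x)) (¬? (g x ≟ x)) (λ ne eq → ne (cong g eq)) (λ ne eq → ne (g-injective eq)))
      (ind-cong (P? (g x)) (P? x) (λ p → subst P (g⁵ x) (iterate-invariant 4 p)) (invariant x))
      where
      iterate-invariant : ∀ k {y} → P y → P (iterate g k y)
      iterate-invariant zero    p = p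
      iterate-invariant (suc k) p = invariant _ (iterate-invariant k p)

    moving-iterate : ∀ k x → moving (iterate g k x) ≡ moving x
    moving-iterate zero    x = refl
    moving-iterate (suc k) x = trans (moving-invariant (iterate g k x)) (moving-iterate k x)

    moving-weighted : ∀ x → moving x ≡ moving x * orbitWeight x
    moving-weighted x = unless-weight-one (g x ≟ x) (ind (P? x)) (orbit-least-unique x)

    sum-moving : sum moving ≡ 5 * orbits
    sum-moving = begin
      sum moving
        ≡⟨ sum-cong-≗ moving-weighted ⟩
      sum (λ x → moving x * orbitWeight x)
        ≡⟨ sum-cong-≗ (λ x → *-distribˡ-sum {5} (moving x) (λ i → leastWeight (iterate g (toℕ i) x))) ⟩
      sum (λ x → sum (λ (i : Fin 5) → moving x * leastWeight (iterate g (toℕ i) x)))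
        ≡⟨ ∑-comm (λ x (i : Fin 5) → moving x * leastWeight (iterate g (toℕ i) x)) ⟩
      sum (λ (i : Fin 5) → sum (λ x → moving x * leastWeight (iterate g (toℕ i) x)))
        ≡⟨ sum-cong-≗ {5} (λ i → sum-cong-≗ (λ x →
             cong (_* leastWeight (iterate g (toℕ i) x)) (sym (moving-iterate (toℕ i) x)))) ⟩
      sum (λ (i : Fin 5) → sum (λ x → moving (iterate g (toℕ i) x) * leastWeight (iterate g (toℕ i) x)))
        ≡⟨ sum-cong-≗ {5} (λ i → reindex (toℕ i) (λ y → moving y * leastWeight y)) ⟩
      sum (λ (i : Fin 5) → orbits)
        ≡⟨ sum-const 5 orbits ⟩
      5 * orbits ∎
      where open ≡-Reasoning

  orbit-count : ∀ {P : Fin n → Set} (P? : ∀ x → Dec (P x)) → (∀ x → P x → P (g x)) →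
                ∃ λ m → sum (λ x → ind (P? x)) ≡ sum (λ x → ind (g x ≟ x) * ind (P? x)) + 5 * m
  orbit-count P? invariant = orbits , (begin
    sum (λ x → ind (P? x))
      ≡⟨ sum-cong-≗ (λ x → ind-split (g x ≟ x) (ind (P? x))) ⟩
    sum (λ x → ind (g x ≟ x) * ind (P? x) + moving x)
      ≡⟨ ∑-distrib-+ (λ x → ind (g x ≟ x) * ind (P? x)) moving ⟩
    sum (λ x → ind (g x ≟ x) * ind (P? x)) + sum moving
      ≡⟨ cong (sum (λ x → ind (g x ≟ x) * ind (P? x)) +_) sum-moving ⟩
    sum (λ x → ind (g x ≟ x) * ind (P? x)) + 5 * orbits ∎)
    where
    open ≡-Reasoning
    open Moving P? invariant

  fixed-count : ∃ λ m → sum (λ x → ind (g x ≟ x)) + 5 * m ≡ n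
  fixed-count = m , sym (begin
    n
      ≡⟨ trans (sym (ℕ.*-identityʳ n)) (sym (sum-const n 1)) ⟩
    sum (λ x → ind (everything x))
      ≡⟨ proj₂ counted ⟩
    sum (λ x → ind (g x ≟ x) * 1) + 5 * m
      ≡⟨ cong (_+ 5 * m) (sum-cong-≗ (λ x → ℕ.*-identityʳ (ind (g x ≟ x)))) ⟩
    sum (λ x → ind (g x ≟ x)) + 5 * m ∎)
    where
    open ≡-Reasoning
    everything : ∀ x → Dec ⊤
    everything _ = yes tt
    counted : ∃ λ m → sum (λ x → ind (everything x)) ≡ sum (λ x → ind (g x ≟ x) * ind (everything x)) + 5 * m
    counted = orbit-count everything (λ _ _ → tt)
    m : ℕ
    m = proj₁ counted

  small-invariant-fixed : ∀ {P : Fin n → Set} (P? : ∀ x → Dec (P x)) → (∀ x → P x → P (g x)) →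
    ∀ {r} → r < 5 → sum (λ x → ind (P? x)) ≡ r → sum (λ x → ind (g x ≟ x) * ind (P? x)) ≡ r
  small-invariant-fixed P? invariant r<5 total = no-full-orbit (orbit-count P? invariant) r<5 total
    where
    no-full-orbit : ∀ {c s} → (∃ λ m → s ≡ c + 5 * m) → ∀ {r} → r < 5 → s ≡ r → c ≡ r
    no-full-orbit (zero  , eq) r<5 s≡r = trans (sym (ℕ.+-identityʳ _)) (trans (sym eq) s≡r)
    no-full-orbit {c} (suc m , eq) {r} r<5 s≡r = ⊥-elim (ℕ.<⇒≱ r<5 (begin
      5              ≤⟨ ℕ.m≤m*n 5 (suc m) ⟩
      5 * suc m      ≤⟨ ℕ.m≤n+m (5 * suc m) c ⟩
      c + 5 * suc m  ≡⟨ trans (sym eq) s≡r ⟩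
      r              ∎))
      where open ℕ.≤-Reasoning

-- t ≥ 6 and the two quadratics (t - 6)(t - 11), (t - 11)(t - 16) are
-- nonnegative; this holds for t ∈ {6, 11, 16}.
QuadBounds : ℕ → Set
QuadBounds t = (6 ≤ t) × (17 * t ≤ t * t + 66) × (27 * t ≤ t * t + 176)

quadBounds? : ∀ t → Dec (QuadBounds t)
quadBounds? t = (6 ℕ.≤? t) ×-dec ((17 * t ℕ.≤? t * t + 66) ×-dec (27 * t ℕ.≤? t * t + 176))

quadBounds : ∀ t → {True (quadBounds? t)} → QuadBounds t
quadBounds t {ok} = toWitness ok

replication-values : ∀ t m → t + 5 * m ≡ 16 → 3 ≤ t → QuadBounds t
replication-values t 0 eq _ = subst QuadBounds (sym (trans (sym (ℕ.+-identityʳ t)) eq)) (quadBounds 16)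
replication-values t 1 eq _ = subst QuadBounds (sym (ℕ.+-cancelʳ-≡ 5 t 11 eq)) (quadBounds 11)
replication-values t 2 eq _ = subst QuadBounds (sym (ℕ.+-cancelʳ-≡ 10 t 6 eq)) (quadBounds 6)
replication-values t (suc (suc (suc m))) eq 3≤t = ⊥-elim (18≰16 (begin
  18                    ≤⟨ ℕ.+-mono-≤ 3≤t (ℕ.*-monoʳ-≤ 5 (ℕ.m≤m+n 3 m)) ⟩
  t + 5 * (3 + m)       ≡⟨ eq ⟩
  16                    ∎))
  where
  open ℕ.≤-Reasoning
  18≰16 : ¬ 18 ≤ 16
  18≰16 = toWitness {a? = ¬? (18 ℕ.≤? 16)} tt

residue : ∀ c m {v} → c + 5 * m ≡ v → c ≡ v ∸ 5 * m
residue c m eq = trans (sym (ℕ.m+n∸n≡m c (5 * m))) (cong (_∸ 5 * m) eq)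

multiplier-bound : ∀ c m → c + 5 * m ≡ 81 → m < 17
multiplier-bound c m eq = ℕ.*-cancelˡ-< 5 m 17
  (ℕ.≤-<-trans (subst (5 * m ≤_) eq (ℕ.m≤n+m (5 * m) c)) (toWitness {a? = 81 ℕ.<? 85} tt))

small-multiples : ∀ {m} → m < 16 → 2 ≤ 81 ∸ 5 * m
small-multiples = toWitness {a? = ℕ.allUpTo? (λ m → 2 ℕ.≤? 81 ∸ 5 * m) 16} tt

eliminate : ∀ a c {I X f φ} → suc a * I ≤ X + c * f → X + 3 * φ ≡ 3 * (φ * φ) + I →
            a * I + 3 * φ ≤ 3 * (φ * φ) + c * f
eliminate a c {I} {X} {f} {φ} bound identity = ℕ.+-cancelˡ-≤ I _ _ (begin
  I + (a * I + 3 * φ)        ≡⟨ ℕ.+-assoc I (a * I) (3 * φ) ⟨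
  suc a * I + 3 * φ          ≤⟨ ℕ.+-monoˡ-≤ (3 * φ) bound ⟩
  X + c * f + 3 * φ          ≡⟨ ℕ.+-assoc X (c * f) (3 * φ) ⟩
  X + (c * f + 3 * φ)        ≡⟨ cong (X +_) (ℕ.+-comm (c * f) (3 * φ)) ⟩
  X + (3 * φ + c * f)        ≡⟨ ℕ.+-assoc X (3 * φ) (c * f) ⟨
  X + 3 * φ + c * f          ≡⟨ cong (_+ c * f) identity ⟩
  3 * (φ * φ) + I + c * f    ≡⟨ cong (_+ c * f) (ℕ.+-comm (3 * (φ * φ)) I) ⟩
  I + 3 * (φ * φ) + c * f    ≡⟨ ℕ.+-assoc I (3 * (φ * φ)) (c * f) ⟩
  I + (3 * (φ * φ) + c * f)  ∎)
  where open ℕ.≤-Reasoning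

bound-via : ∀ a k {J I s R} → J ≤ I + k → a * I + s ≤ R → a * J + s ≤ R + a * k
bound-via a k {J} {I} {s} {R} J≤I+k aI+s≤R = begin
  a * J + s            ≤⟨ ℕ.+-monoˡ-≤ s (ℕ.*-monoʳ-≤ a J≤I+k) ⟩
  a * (I + k) + s      ≡⟨ cong (_+ s) (ℕ.*-distribˡ-+ a I k) ⟩
  a * I + a * k + s    ≡⟨ ℕ.+-assoc (a * I) (a * k) s ⟩
  a * I + (a * k + s)  ≡⟨ cong (a * I +_) (ℕ.+-comm (a * k) s) ⟩
  a * I + (s + a * k)  ≡⟨ ℕ.+-assoc (a * I) s (a * k) ⟨
  a * I + s + a * k    ≤⟨ ℕ.+-monoˡ-≤ (a * k) aI+s≤R ⟩
  R + a * k            ∎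
  where open ℕ.≤-Reasoning

-- The three conditions on (f, φ) obtained by eliminating I and X: from
-- 16 I + 3φ ≤ 3φ² + 66 f with 6 f ≤ I and with 16φ + f ≤ I + 81, and from
-- 26 I + 3φ ≤ 3φ² + 176 f with 16φ + f ≤ I + 81.
Admissible : ℕ → ℕ → Set
Admissible f φ = (16 * (6 * f) + 3 * φ ≤ 3 * (φ * φ) + 66 * f)
               × (16 * (16 * φ + f) + 3 * φ ≤ 3 * (φ * φ) + 66 * f + 16 * 81)
               × (26 * (16 * φ + f) + 3 * φ ≤ 3 * (φ * φ) + 176 * f + 26 * 81)

admissible? : ∀ f φ → Dec (Admissible f φ)
admissible? f φ = (16 * (6 * f) + 3 * φ ℕ.≤? 3 * (φ * φ) + 66 * f)
           ×-dec ((16 * (16 * φ + f) + 3 * φ ℕ.≤? 3 * (φ * φ) + 66 * f + 16 * 81)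
           ×-dec (26 * (16 * φ + f) + 3 * φ ℕ.≤? 3 * (φ * φ) + 176 * f + 26 * 81))

no-admissible-pair : ∀ {m} → m < 15 → ∀ {m'} → m' < 17 → ¬ Admissible (81 ∸ 5 * suc m) (81 ∸ 5 * m')
no-admissible-pair = toWitness {a? = ℕ.allUpTo? (λ m → ℕ.allUpTo? (λ m' → ¬? (pair? m m')) 17) 15} tt
  where
  pair? : ∀ m m' → Dec (Admissible (81 ∸ 5 * suc m) (81 ∸ 5 * m'))
  pair? m m' = admissible? (81 ∸ 5 * suc m) (81 ∸ 5 * m')

module FixedStructure (B : Fin 81 → Subset 81) (design : IsSymmetricDesign 81 16 3 B)
  (α : Permutation′ 81) (auto : IsAutomorphism B α) (order : HasOrder α 5) where
  open IsSymmetricDesign design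

  g : Fin 81 → Fin 81
  g p = α ⟨$⟩ʳ p

  β : Fin 81 → Fin 81
  β b = proj₁ (auto b)

  g⁵ : ∀ p → iterate g 5 p ≡ p
  g⁵ = proj₁ (proj₂ order)

  transport : ∀ k b p → p ∈ B b → iterate g k p ∈ B (iterate β k b)
  transport zero    b p p∈b = p∈b
  transport (suc k) b p p∈b = Equivalence.to (proj₂ (auto (iterate β k b)) _) (transport k b p p∈b)

  transport⁻¹ : ∀ k b p → iterate g k p ∈ B (iterate β k b) → p ∈ B b
  transport⁻¹ zero    b p gp∈βb = gp∈βb
  transport⁻¹ (suc k) b p gp∈βb =
    transport⁻¹ k b p (Equivalence.from (proj₂ (auto (iterate β k b)) _) gp∈βb)

  -- β⁵ = id, because β⁵ b and b are blocks with the same points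
  β⁵ : ∀ b → iterate β 5 b ≡ b
  β⁵ b = distinct _ _ (⊆-antisym β⁵b⊆b b⊆β⁵b)
    where
    β⁵b⊆b : B (iterate β 5 b) ⊆ B b
    β⁵b⊆b {p} p∈ = transport⁻¹ 5 b p (subst (_∈ B (iterate β 5 b)) (sym (g⁵ p)) p∈)
    b⊆β⁵b : B b ⊆ B (iterate β 5 b)
    b⊆β⁵b {p} p∈ = subst (_∈ B (iterate β 5 b)) (g⁵ p) (transport 5 b p p∈)

  module Points = OrderFive g g⁵
  module Blocks = OrderFive β β⁵

  fixedPt fixedBl : Fin 81 → ℕ
  fixedPt p = ind (g p ≟ p)
  fixedBl b = ind (β b ≟ b)

  inc : Fin 81 → Fin 81 → ℕ
  inc p b = ind (p ∈? B b)

  f φ : ℕ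
  f = sum fixedPt
  φ = sum fixedBl

  t : Fin 81 → ℕ
  t p = sum (λ b → fixedBl b * inc p b)

  points-mod-5 : ∃ λ m → f + 5 * m ≡ 81
  points-mod-5 = Points.fixed-count

  blocks-mod-5 : ∃ λ m → φ + 5 * m ≡ 81
  blocks-mod-5 = Blocks.fixed-count

  -- A fixed point lies on 16 blocks, permuted by β, so t p ≡ 16 (mod 5).
  t-mod-5 : ∀ p → g p ≡ p → ∃ λ m → t p + 5 * m ≡ 16
  t-mod-5 p fp = proj₁ counted , trans (sym (proj₂ counted))
    (trans (sym (count-as-sum (λ b → p ∈ B b) (λ b → p ∈? B b))) (repl p))
    where
    on-image : ∀ b → p ∈ B b → p ∈ B (β b)
    on-image b p∈b = subst (_∈ B (β b)) fp (transport 1 b p p∈b)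
    counted : ∃ λ m → sum (λ b → inc p b) ≡ t p + 5 * m
    counted = Blocks.orbit-count (λ b → p ∈? B b) on-image

  fixed-blocks-on-pair : ∀ p q → g p ≡ p → g q ≡ q → p ≢ q →
    sum (λ b → fixedBl b * (inc p b * inc q b)) ≡ 3
  fixed-blocks-on-pair p q fp fq p≢q =
    trans (sum-cong-≗ (λ b → cong (fixedBl b *_) (sym (ind-× (p ∈? B b) (q ∈? B b)))))
          (Blocks.small-invariant-fixed on-both? on-image (s≤s (s≤s (s≤s (s≤s z≤n))))
             (trans (sym (count-as-sum (λ b → p ∈ B b × q ∈ B b) on-both?)) (pointPair p q p≢q)))
    where
    on-both? : ∀ b → Dec (p ∈ B b × q ∈ B b)
    on-both? b = (p ∈? B b) ×-dec (q ∈? B b)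
    on-image : ∀ b → p ∈ B b × q ∈ B b → p ∈ B (β b) × q ∈ B (β b)
    on-image b (p∈b , q∈b) = subst (_∈ B (β b)) fp (transport 1 b p p∈b)
                           , subst (_∈ B (β b)) fq (transport 1 b q q∈b)

  common-points : ∀ b c → b ≢ c → sum (λ x → ind ((x ∈? B b) ×-dec (x ∈? B c))) ≡ 3
  common-points b c b≢c =
    trans (sym (sum-cong-≗ as-∩)) (trans (sym (card-as-sum (B b ∩ B c))) (blockMeet b c b≢c))
    where
    as-∩ : ∀ x → ind (x ∈? B b ∩ B c) ≡ ind ((x ∈? B b) ×-dec (x ∈? B c))
    as-∩ x = ind-cong (x ∈? B b ∩ B c) ((x ∈? B b) ×-dec (x ∈? B c)) (x∈p∩q⁻ (B b) (B c)) x∈p∩q⁺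

  fixed-points-on-meet : ∀ b c → β b ≡ b → β c ≡ c → b ≢ c →
    sum (λ x → fixedPt x * ind ((x ∈? B b) ×-dec (x ∈? B c))) ≡ 3
  fixed-points-on-meet b c fb fc b≢c =
    Points.small-invariant-fixed (λ x → (x ∈? B b) ×-dec (x ∈? B c)) on-image (s≤s (s≤s (s≤s (s≤s z≤n))))
      (common-points b c b≢c)
    where
    on-image : ∀ x → x ∈ B b × x ∈ B c → g x ∈ B b × g x ∈ B c
    on-image x (x∈b , x∈c) = subst (λ d → g x ∈ B d) fb (transport 1 b x x∈b)
                           , subst (λ d → g x ∈ B d) fc (transport 1 c x x∈c)

  meet-fixed : ∀ b c x → β b ≡ b → β c ≡ c → b ≢ c → x ∈ B b → x ∈ B c → g x ≡ x
  meet-fixed b c x fb fc b≢c x∈b x∈c =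
    full-weight (λ y → g y ≟ y) (λ y → ind ((y ∈? B b) ×-dec (y ∈? B c)))
      (trans (fixed-points-on-meet b c fb fc b≢c) (sym (common-points b c b≢c)))
      x (subst (0 <_) (sym (ind-yes ((x ∈? B b) ×-dec (x ∈? B c)) (x∈b , x∈c))) (s≤s z≤n))

  not-all-fixed : f ≢ 81
  not-all-fixed f≡81 = proj₂ (proj₂ order) 1 (s≤s z≤n) (s≤s (s≤s z≤n)) all-fixed
    where
    all-fixed : ∀ p → g p ≡ p
    all-fixed p = full-weight (λ x → g x ≟ x) (λ _ → 1)
      (trans (sum-cong-≗ (λ x → ℕ.*-identityʳ (fixedPt x))) (trans f≡81 (sym (sum-const 81 1))))
      p (s≤s z≤n)

  another-fixed : 2 ≤ f → ∀ p → g p ≡ p → ∃ λ q → g q ≡ q × p ≢ q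
  another-fixed 2≤f p fp = q , proj₂ q-props , λ p≡q → proj₁ q-props (sym p≡q)
    where
    others : Fin 81 → ℕ
    others q = ind (¬? (q ≟ p)) * fixedPt q
    f≡1+others : f ≡ 1 + sum others
    f≡1+others = begin
      f
        ≡⟨ sum-cong-≗ (λ q → ind-split (q ≟ p) (fixedPt q)) ⟩
      sum (λ q → ind (q ≟ p) * fixedPt q + others q)
        ≡⟨ ∑-distrib-+ (λ q → ind (q ≟ p) * fixedPt q) others ⟩
      sum (λ q → ind (q ≟ p) * fixedPt q) + sum others
        ≡⟨ cong (_+ sum others) (trans (sum-δ p fixedPt) (ind-yes (g p ≟ p) fp)) ⟩
      1 + sum others ∎
      where open ≡-Reasoning
    found : ∃ λ q → 0 < others q
    found = sum-positive others (s≤s⁻¹ (subst (2 ≤_) f≡1+others 2≤f))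
    q : Fin 81
    q = proj₁ found
    q-props : q ≢ p × g q ≡ q
    q-props = ind-×-positive (¬? (q ≟ p)) (g q ≟ q) (proj₂ found)

  t≥3 : 2 ≤ f → ∀ p → g p ≡ p → 3 ≤ t p
  t≥3 2≤f p fp = subst (_≤ t p) (fixed-blocks-on-pair p q fp fq p≢q) (sum-mono-≤ on-both≤on-p)
    where
    companion : ∃ λ q → g q ≡ q × p ≢ q
    companion = another-fixed 2≤f p fp
    q : Fin 81
    q = proj₁ companion
    fq : g q ≡ q
    fq = proj₁ (proj₂ companion)
    p≢q : p ≢ q
    p≢q = proj₂ (proj₂ companion)
    on-both≤on-p : ∀ b → fixedBl b * (inc p b * inc q b) ≤ fixedBl b * inc p b
    on-both≤on-p b = ℕ.*-monoʳ-≤ (fixedBl b)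
      (subst (inc p b * inc q b ≤_) (ℕ.*-identityʳ (inc p b)) (ℕ.*-monoʳ-≤ (inc p b) (ind≤1 (q ∈? B b))))

  fixed-t-values : 2 ≤ f → ∀ p → g p ≡ p → QuadBounds (t p)
  fixed-t-values 2≤f p fp =
    replication-values (t p) (proj₁ (t-mod-5 p fp)) (proj₂ (t-mod-5 p fp)) (t≥3 2≤f p fp)

  -- A non-fixed point lies on at most one fixed block (two fixed blocks
  -- meet only in fixed points).
  t≤1 : ∀ x → g x ≢ x → t x ≤ 1
  t≤1 x moving = sum-≤1 (λ b → fixedBl b * inc x b) term≤1 unique
    where
    term≤1 : ∀ b → fixedBl b * inc x b ≤ 1
    term≤1 b = ℕ.*-mono-≤ (ind≤1 (β b ≟ b)) (ind≤1 (x ∈? B b))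
    unique : ∀ b c → 0 < fixedBl b * inc x b → 0 < fixedBl c * inc x c → b ≡ c
    unique b c on-b on-c with b ≟ c
    ... | yes b≡c = b≡c
    ... | no  b≢c = ⊥-elim (moving
                      (meet-fixed b c x (proj₁ b-props) (proj₁ c-props) b≢c (proj₂ b-props) (proj₂ c-props)))
      where
      b-props : β b ≡ b × x ∈ B b
      b-props = ind-×-positive (β b ≟ b) (x ∈? B b) on-b
      c-props : β c ≡ c × x ∈ B c
      c-props = ind-×-positive (β c ≟ c) (x ∈? B c) on-c

  I X : ℕ
  I = sum (λ p → fixedPt p * t p)
  X = sum (λ p → fixedPt p * (t p * t p))

  sum-fixed-mono : ∀ (u v : Fin 81 → ℕ) → (∀ p → g p ≡ p → u p ≤ v p) →
                   sum (λ p → fixedPt p * u p) ≤ sum (λ p → fixedPt p * v p)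
  sum-fixed-mono u v u≤v = sum-mono-≤ (λ p →
    ind-elim (λ i → i * u p ≤ i * v p) (g p ≟ p) (λ _ → z≤n) (λ fp → ℕ.+-monoˡ-≤ 0 (u≤v p fp)))

  linear-bound : (∀ p → g p ≡ p → 6 ≤ t p) → 6 * f ≤ I
  linear-bound 6≤t = begin
    6 * f                          ≡⟨ ℕ.*-comm 6 f ⟩
    f * 6                          ≡⟨ *-distribʳ-sum 6 fixedPt ⟩
    sum (λ p → fixedPt p * 6)      ≤⟨ sum-fixed-mono (λ _ → 6) t 6≤t ⟩
    I                              ∎
    where open ℕ.≤-Reasoning

  quadratic-bound : ∀ a c → (∀ p → g p ≡ p → a * t p ≤ t p * t p + c) → a * I ≤ X + c * f
  quadratic-bound a c bound = begin
    a * I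
      ≡⟨ *-distribˡ-sum a (λ p → fixedPt p * t p) ⟩
    sum (λ p → a * (fixedPt p * t p))
      ≡⟨ sum-cong-≗ (λ p → x∙yz≈y∙xz a (fixedPt p) (t p)) ⟩
    sum (λ p → fixedPt p * (a * t p))
      ≤⟨ sum-fixed-mono (λ p → a * t p) (λ p → t p * t p + c) bound ⟩
    sum (λ p → fixedPt p * (t p * t p + c))
      ≡⟨ sum-cong-≗ (λ p → ℕ.*-distribˡ-+ (fixedPt p) (t p * t p) c) ⟩
    sum (λ p → fixedPt p * (t p * t p) + fixedPt p * c)
      ≡⟨ ∑-distrib-+ (λ p → fixedPt p * (t p * t p)) (λ p → fixedPt p * c) ⟩
    X + sum (λ p → fixedPt p * c)
      ≡⟨ cong (X +_) (trans (ℕ.*-comm c f) (*-distribʳ-sum c fixedPt)) ⟨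
    X + c * f ∎
    where open ℕ.≤-Reasoning

  -- Each of the φ fixed blocks has 16 points: Σₓ t x = 16 φ.
  t-total : sum t ≡ 16 * φ
  t-total = begin
    sum t
      ≡⟨ sum-cong-≗ (λ x → ℕ.*-identityˡ (t x)) ⟨
    sum (λ x → 1 * t x)
      ≡⟨ double-count (λ _ → 1) fixedBl inc ⟩
    sum (λ b → fixedBl b * sum (λ x → 1 * inc x b))
      ≡⟨ sum-cong-≗ (λ b → cong (fixedBl b *_) (block-size b)) ⟩
    sum (λ b → fixedBl b * 16)
      ≡⟨ *-distribʳ-sum 16 fixedBl ⟨
    φ * 16
      ≡⟨ ℕ.*-comm φ 16 ⟩
    16 * φ ∎
    where
    open ≡-Reasoning
    block-size : ∀ b → sum (λ x → 1 * inc x b) ≡ 16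
    block-size b = trans (sum-cong-≗ (λ x → ℕ.*-identityˡ (inc x b)))
                         (trans (sym (card-as-sum (B b))) (blockSize b))

  incidence-bound : 16 * φ + f ≤ I + 81
  incidence-bound = begin
    16 * φ + f                          ≡⟨ cong (_+ f) t-total ⟨
    sum t + f                           ≡⟨ ∑-distrib-+ t fixedPt ⟨
    sum (λ x → t x + fixedPt x)         ≤⟨ sum-mono-≤ pointwise ⟩
    sum (λ x → fixedPt x * t x + 1)     ≡⟨ ∑-distrib-+ (λ x → fixedPt x * t x) (λ _ → 1) ⟩
    I + sum (λ (_ : Fin 81) → 1)        ≡⟨ cong (I +_) (sum-const 81 1) ⟩
    I + 81                              ∎
    where
    open ℕ.≤-Reasoning
    pointwise : ∀ x → t x + fixedPt x ≤ fixedPt x * t x + 1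
    pointwise x = ind-elim (λ i → t x + i ≤ i * t x + 1) (g x ≟ x)
      (λ moving → subst (_≤ 1) (sym (ℕ.+-identityʳ (t x))) (t≤1 x moving))
      (λ _ → ℕ.≤-reflexive (cong (_+ 1) (sym (ℕ.+-identityʳ (t x)))))

  s u : Fin 81 → ℕ
  s c = sum (λ p → fixedPt p * inc p c)
  u c = sum (λ p → (fixedPt p * t p) * inc p c)

  M : Fin 81 → Fin 81 → ℕ
  M b c = sum (λ p → (fixedPt p * inc p c) * inc p b)

  I-dual : I ≡ sum (λ c → fixedBl c * s c)
  I-dual = double-count fixedPt fixedBl inc

  X-dual : X ≡ sum (λ c → fixedBl c * u c)
  X-dual = trans (sum-cong-≗ (λ p → sym (ℕ.*-assoc (fixedPt p) (t p) (t p))))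
                 (double-count (λ p → fixedPt p * t p) fixedBl inc)

  u-dual : ∀ c → u c ≡ sum (λ b → fixedBl b * M b c)
  u-dual c = trans (sum-cong-≗ (λ p → xy∙z≈xz∙y (fixedPt p) (t p) (inc p c)))
                   (double-count (λ p → fixedPt p * inc p c) fixedBl inc)

  M-diagonal : ∀ c → M c c ≡ s c
  M-diagonal c = sum-cong-≗ (λ p →
    trans (ℕ.*-assoc (fixedPt p) (inc p c) (inc p c)) (cong (fixedPt p *_) (ind-idem (p ∈? B c))))

  M-off-diagonal : ∀ b c → β b ≡ b → β c ≡ c → b ≢ c → M b c ≡ 3
  M-off-diagonal b c fb fc b≢c = trans (sum-cong-≗ as-meet) (fixed-points-on-meet b c fb fc b≢c)
    where
    as-meet : ∀ p → (fixedPt p * inc p c) * inc p b ≡ fixedPt p * ind ((p ∈? B b) ×-dec (p ∈? B c))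
    as-meet p = trans (sym (x∙yz≈xz∙y (fixedPt p) (inc p b) (inc p c)))
                      (cong (fixedPt p *_) (sym (ind-× (p ∈? B b) (p ∈? B c))))

  -- Termwise form of Σ_b fixedBl b · M b c = M c c + 3 (φ - 1) for fixed c.
  meet-term : ∀ c → β c ≡ c → ∀ b →
              fixedBl b * M b c + ind (b ≟ c) * 3 ≡ ind (b ≟ c) * M c c + fixedBl b * 3
  meet-term c fc b with b ≟ c
  ... | yes refl = subst (λ i → i * M c c + 1 * 3 ≡ 1 * M c c + i * 3) (sym (ind-yes (β c ≟ c) fc)) refl
  ... | no  b≢c  = ind-elim (λ i → i * M b c + 0 * 3 ≡ 0 * M c c + i * 3) (β b ≟ b) (λ _ → refl)
                     (λ fb → cong (λ m → m + 0 + 0) (M-off-diagonal b c fb fc b≢c))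

  u-fixed : ∀ c → β c ≡ c → u c + 3 ≡ s c + φ * 3
  u-fixed c fc = begin
    u c + 3
      ≡⟨ cong₂ _+_ (u-dual c) (sym (sum-δ c (λ _ → 3))) ⟩
    sum (λ b → fixedBl b * M b c) + sum (λ b → ind (b ≟ c) * 3)
      ≡⟨ ∑-distrib-+ (λ b → fixedBl b * M b c) (λ b → ind (b ≟ c) * 3) ⟨
    sum (λ b → fixedBl b * M b c + ind (b ≟ c) * 3)
      ≡⟨ sum-cong-≗ (meet-term c fc) ⟩
    sum (λ b → ind (b ≟ c) * M c c + fixedBl b * 3)
      ≡⟨ ∑-distrib-+ (λ b → ind (b ≟ c) * M c c) (λ b → fixedBl b * 3) ⟩
    sum (λ b → ind (b ≟ c) * M c c) + sum (λ b → fixedBl b * 3)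
      ≡⟨ cong₂ _+_ (trans (sum-δ c (λ _ → M c c)) (M-diagonal c)) (sym (*-distribʳ-sum 3 fixedBl)) ⟩
    s c + φ * 3 ∎
    where open ≡-Reasoning

  -- Counting triples (p, b, c) with p fixed on the fixed blocks b, c:
  -- X + 3 φ = 3 φ² + I.
  fixed-pair-identity : X + 3 * φ ≡ 3 * (φ * φ) + I
  fixed-pair-identity = begin
    X + 3 * φ
      ≡⟨ cong₂ _+_ X-dual (trans (ℕ.*-comm 3 φ) (*-distribʳ-sum 3 fixedBl)) ⟩
    sum (λ c → fixedBl c * u c) + sum (λ c → fixedBl c * 3)
      ≡⟨ ∑-distrib-+ (λ c → fixedBl c * u c) (λ c → fixedBl c * 3) ⟨
    sum (λ c → fixedBl c * u c + fixedBl c * 3)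
      ≡⟨ sum-cong-≗ (λ c → ℕ.*-distribˡ-+ (fixedBl c) (u c) 3) ⟨
    sum (λ c → fixedBl c * (u c + 3))
      ≡⟨ sum-cong-≗ (λ c → ind-*-cong (β c ≟ c) (u-fixed c)) ⟩
    sum (λ c → fixedBl c * (s c + φ * 3))
      ≡⟨ sum-cong-≗ (λ c → ℕ.*-distribˡ-+ (fixedBl c) (s c) (φ * 3)) ⟩
    sum (λ c → fixedBl c * s c + fixedBl c * (φ * 3))
      ≡⟨ ∑-distrib-+ (λ c → fixedBl c * s c) (λ c → fixedBl c * (φ * 3)) ⟩
    sum (λ c → fixedBl c * s c) + sum (λ c → fixedBl c * (φ * 3))
      ≡⟨ cong₂ _+_ I-dual (*-distribʳ-sum (φ * 3) fixedBl) ⟨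
    I + φ * (φ * 3)
      ≡⟨ ℕ.+-comm I _ ⟩
    φ * (φ * 3) + I
      ≡⟨ cong (_+ I) (trans (sym (ℕ.*-assoc φ φ 3)) (ℕ.*-comm (φ * φ) 3)) ⟩
    3 * (φ * φ) + I ∎
    where open ≡-Reasoning

  admissible : 2 ≤ f → Admissible f φ
  admissible 2≤f = ℕ.≤-trans (ℕ.+-monoˡ-≤ (3 * φ) (ℕ.*-monoʳ-≤ 16 linear-bound′)) quad₁₆
                 , bound-via 16 81 {16 * φ + f} {I} incidence-bound quad₁₆
                 , bound-via 26 81 {16 * φ + f} {I} incidence-bound quad₂₆
    where
    bounds : ∀ p → g p ≡ p → QuadBounds (t p)
    bounds = fixed-t-values 2≤f
    linear-bound′ : 6 * f ≤ I
    linear-bound′ = linear-bound (λ p fp → proj₁ (bounds p fp))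
    quad₁₆ : 16 * I + 3 * φ ≤ 3 * (φ * φ) + 66 * f
    quad₁₆ = eliminate 16 66 {I} {X} {f} {φ}
               (quadratic-bound 17 66 (λ p fp → proj₁ (proj₂ (bounds p fp)))) fixed-pair-identity
    quad₂₆ : 26 * I + 3 * φ ≤ 3 * (φ * φ) + 176 * f
    quad₂₆ = eliminate 26 176 {I} {X} {f} {φ}
               (quadratic-bound 27 176 (λ p fp → proj₂ (proj₂ (bounds p fp)))) fixed-pair-identity


lemma3p3 : (B : Fin 81 → Subset 81) → IsSymmetricDesign 81 16 3 B →
    (α : Permutation′ 81) → IsAutomorphism B α → HasOrder α 5 →
    numFixed α ≡ 1
lemma3p3 B design α auto order =
  trans (count-as-sum (λ p → α ⟨$⟩ʳ p ≡ p) (λ p → (α ⟨$⟩ʳ p) ≟ p)) (f≡1 points-mod-5)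
  where
  open FixedStructure B design α auto order
  -- f + 5m = 81: m = 0 is excluded as α ≠ id, m = 16 gives f = 1, and for
  -- 1 ≤ m ≤ 15 (so f ≥ 6) the pair (f, φ) would have to be admissible.
  f≡1 : (∃ λ m → f + 5 * m ≡ 81) → f ≡ 1
  f≡1 (zero  , eq) = ⊥-elim (not-all-fixed (trans (sym (ℕ.+-identityʳ f)) eq))
  f≡1 (suc m , eq) = [ excluded , last ]′ (ℕ.m≤n⇒m<n∨m≡n (s≤s⁻¹ (s≤s⁻¹ (multiplier-bound f (suc m) eq))))
    where
    f≡ : f ≡ 81 ∸ 5 * suc m
    f≡ = residue f (suc m) eq
    last : m ≡ 15 → f ≡ 1
    last m≡15 = trans f≡ (cong (λ k → 81 ∸ 5 * suc k) m≡15)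
    excluded : m < 15 → f ≡ 1
    excluded m<15 = ⊥-elim (no-admissible-pair m<15 (multiplier-bound φ m′ φ-eq)
      (subst₂ Admissible f≡ (residue φ m′ φ-eq)
        (admissible (subst (2 ≤_) (sym f≡) (small-multiples (s≤s m<15))))))
      where
      m′ : ℕ
      m′ = proj₁ blocks-mod-5
      φ-eq : φ + 5 * m′ ≡ 81
      φ-eq = proj₂ blocks-mod-5
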